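{- Let $J$, $M$ be finite sets; for each $j\in J$ let $\mathcal{F}_j$ be a matroid on $M$ with rank function $r_j$, let $q_j>0$, and let $f_j(S) = q_j/r_j(S)$ (with $f_j(S)=\infty$ if $r_j(S)=0$). Let $C>0$, $t_j := \lceil q_j/C\rceil$ for $j\in J$, and $J_1 := \{j \in J : t_j = 1\}$. If there is an assignment $\mathbf{S}=(S_j)_{j\in J}$ (non-empty $S_j\subseteq M$) with maximum load $\max_{i\in M}\sum_{j: i \in S_j} f_j(S_j)$ at most $C$, then the following linear system in variables $x_{ij}$ ($i\in M$, $j\in J_1$) has a feasible solution: $\sum_{i\in M} x_{ij} = 1$ for all $j\in J_1$; $\sum_{j\in J_1} q_j x_{ij} \le C$ for all $i\in M$; $x\ge 0$.
   Context: A matroid on $M$ is a non-empty family $\mathcal{F}\subseteq 2^M$ closed under subsets and satisfying: for $S,T\in\mathcal{F}$ with $|S|<|T|$ there is $i\in T\setminus S$ with $S\cup\{i\}\in\mathcal{F}$. Its rank function is $r(S)=\max\{|T|: T\subseteq S, T\in\mathcal{F}\}$.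
   Formalization: The parameters $q_j$ and $C$ are rational, and the unknowns $x_{ij}$ of the linear system are taken in ℚ. -}

module Defs where

open import Data.Nat as ℕ using (ℕ; zero; suc)
open import Data.Integer as ℤ using (ℤ; +_)
open import Data.Rational as ℚ using (ℚ; 0ℚ; _+_; _*_; _÷_; _/_; positive; ceiling)
open import Data.Rational.Properties using (pos⇒nonZero)
open import Data.Fin using (Fin; zero; suc)
open import Data.Fin.Subset using (Subset; _∈_; _∉_; _⊆_; _∪_; ⁅_⁆; ∣_∣; Nonempty)
open import Data.Fin.Subset.Properties using (_∈?_)
open import Data.Product using (Σ; ∃; _×_; _,_)
open import Relation.Nullary using (does)
open import Relation.Binary.PropositionalEquality using (_≡_)
open import Data.Bool using (if_then_else_)
open import Data.Unit using (⊤)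
open import Data.Empty using (⊥)

record IsMatroid {n : ℕ} (F : Subset n → Set) : Set where
  field
    nonempty  : ∃ λ S → F S
    down      : ∀ S T → S ⊆ T → F T → F S
    exchange  : ∀ S T → F S → F T → ∣ S ∣ ℕ.< ∣ T ∣ →
                ∃ λ i → i ∈ T × i ∉ S × F (S ∪ ⁅ i ⁆)

IsRankFunctionOf : {n : ℕ} → (Subset n → Set) → (Subset n → ℕ) → Set
IsRankFunctionOf F r =
  ∀ S → (∃ λ T → T ⊆ S × F T × ∣ T ∣ ≡ r S)
      × (∀ T → T ⊆ S → F T → ∣ T ∣ ℕ.≤ r S)

data ℚ∞ : Set where
  fin : ℚ → ℚ∞
  ∞   : ℚ∞

_+∞_ : ℚ∞ → ℚ∞ → ℚ∞
fin a +∞ fin b = fin (a + b)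
fin _ +∞ ∞     = ∞
∞     +∞ _     = ∞

_≤∞_ : ℚ∞ → ℚ∞ → Set
fin a ≤∞ fin b = a ℚ.≤ b
fin _ ≤∞ ∞     = ⊤
∞     ≤∞ fin _ = ⊥
∞     ≤∞ ∞     = ⊤

fval : ℚ → ℕ → ℚ∞
fval q zero    = ∞
fval q (suc k) = fin (q * (+ 1 / suc k))

Σℚ : (m : ℕ) → (Fin m → ℚ) → ℚ
Σℚ zero    g = 0ℚ
Σℚ (suc m) g = g zero + Σℚ m (λ j → g (suc j))

Σℚ∞ : (m : ℕ) → (Fin m → ℚ∞) → ℚ∞
Σℚ∞ zero    g = fin 0ℚ
Σℚ∞ (suc m) g = g zero +∞ Σℚ∞ m (λ j → g (suc j))

load : {m n : ℕ} → (q : Fin m → ℚ) → (r : Fin m → Subset n → ℕ) →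
       (S : Fin m → Subset n) → Fin n → ℚ∞
load {m} q r S i = Σℚ∞ m (λ j → if does (i ∈? S j) then fval (q j) (r j (S j)) else fin 0ℚ)

tval : (q C : ℚ) → 0ℚ ℚ.< C → ℤ
tval q C C>0 = ceiling ((q ÷ C) {{pos⇒nonZero C {{positive C>0}}}})

InJ₁ : (q C : ℚ) → 0ℚ ℚ.< C → Set
InJ₁ q C C>0 = tval q C C>0 ≡ + 1

-- Take the fractional assignment x i j = 1/|S_j| for i ∈ S_j (0 otherwise).
-- Each column sums to 1, and since r_j(S_j) ≤ |S_j| we have
-- q_j / |S_j| ≤ q_j / r_j(S_j) = f_j(S_j); hence the fractional load on a
-- machine, even restricted to J₁, is bounded by the load of S, which is ≤ C.
module Submission where

open import Defs
open import Data.Nat using (ℕ)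
open import Data.Integer using (+_)
open import Data.Rational using (ℚ; 0ℚ; 1ℚ; _<_; _≤_; _*_)
open import Data.Integer using (_≟_)
open import Data.Fin using (Fin)
open import Data.Fin.Subset using (Subset; Nonempty)
open import Data.Product using (Σ; _×_)
open import Data.Bool using (if_then_else_)
open import Relation.Nullary using (does)
open import Relation.Binary.PropositionalEquality using (_≡_)

open import Data.Nat as ℕ using (zero; suc; NonZero)
import Data.Nat.Properties as ℕP
import Data.Integer as ℤ
open import Data.Rational as ℚ using (_+_; _/_; toℚᵘ)
import Data.Rational.Properties as ℚP
open import Data.Rational.Unnormalised as ℚᵘ using (ℚᵘ; mkℚᵘ; *≡*; *≤*)
import Data.Rational.Unnormalised.Properties as ℚᵘP
open import Algebra.Properties.Monoid.Mult ℚP.+-0-monoid using () renaming (_×_ to _×ℚ_)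
open import Data.Fin using (zero; suc)
open import Data.Fin.Subset using (inside; outside; ∣_∣)
open import Data.Fin.Subset.Properties using (_∈?_; p⊆q⇒∣p∣≤∣q∣)
open import Data.Vec using ([]; _∷_; there)
open import Data.Bool using (true; false)
open import Data.Product using (_,_; proj₁)
open import Data.Unit using (tt)
open import Relation.Binary.PropositionalEquality using (refl; trans; cong; subst)

-- The junk value 1/ℕ 0 = 0 is never summed: it only occurs for empty S_j.
1/ℕ : ℕ → ℚ
1/ℕ zero    = 0ℚ
1/ℕ (suc k) = + 1 / suc k

1/ℕ-nonNeg : ∀ s → 0ℚ ≤ 1/ℕ s
1/ℕ-nonNeg zero    = ℚP.≤-refl
1/ℕ-nonNeg (suc k) = ℚP.nonNegative⁻¹ (+ 1 / suc k) {{ℚP.normalize-nonNeg 1 (suc k)}}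

1/ℕ-antimono-≤ : ∀ {k l} → k ℕ.≤ l → + 1 / suc l ≤ + 1 / suc k
1/ℕ-antimono-≤ {k} {l} k≤l = ℚP.toℚᵘ-cancel-≤ (begin
  toℚᵘ (+ 1 / suc l)  ≃⟨ ℚP.toℚᵘ-fromℚᵘ (mkℚᵘ (+ 1) l) ⟩
  mkℚᵘ (+ 1) l        ≤⟨ *≤* (ℤ.+≤+ (ℕ.s≤s (ℕP.+-monoˡ-≤ 0 k≤l))) ⟩
  mkℚᵘ (+ 1) k        ≃⟨ ℚᵘP.≃-sym (ℚP.toℚᵘ-fromℚᵘ (mkℚᵘ (+ 1) k)) ⟩
  toℚᵘ (+ 1 / suc k)  ∎)
  where open ℚᵘP.≤-Reasoning

ℕ→ℚᵘ : ℕ → ℚᵘ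
ℕ→ℚᵘ n = mkℚᵘ (+ n) 0

1+ℕ→ℚᵘ : ∀ n → ℚᵘ.1ℚᵘ ℚᵘ.+ ℕ→ℚᵘ n ℚᵘ.≃ ℕ→ℚᵘ (suc n)
1+ℕ→ℚᵘ zero    = *≡* refl
1+ℕ→ℚᵘ (suc n) = *≡* (cong (λ k → + suc (suc k)) (ℕP.*-identityʳ _))

toℚᵘ-×ℚ : ∀ n c → toℚᵘ (n ×ℚ c) ℚᵘ.≃ ℕ→ℚᵘ n ℚᵘ.* toℚᵘ c
toℚᵘ-×ℚ zero    c = ℚᵘP.≃-sym (ℚᵘP.*-zeroˡ (toℚᵘ c))
toℚᵘ-×ℚ (suc n) c = begin
  toℚᵘ (c + n ×ℚ c)                                 ≈⟨ ℚP.toℚᵘ-homo-+ c (n ×ℚ c) ⟩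
  toℚᵘ c ℚᵘ.+ toℚᵘ (n ×ℚ c)                         ≈⟨ ℚᵘP.+-cong (ℚᵘP.≃-sym (ℚᵘP.*-identityˡ (toℚᵘ c))) (toℚᵘ-×ℚ n c) ⟩
  ℚᵘ.1ℚᵘ ℚᵘ.* toℚᵘ c ℚᵘ.+ ℕ→ℚᵘ n ℚᵘ.* toℚᵘ c       ≈⟨ ℚᵘP.≃-sym (ℚᵘP.*-distribʳ-+ (toℚᵘ c) ℚᵘ.1ℚᵘ (ℕ→ℚᵘ n)) ⟩
  (ℚᵘ.1ℚᵘ ℚᵘ.+ ℕ→ℚᵘ n) ℚᵘ.* toℚᵘ c                  ≈⟨ ℚᵘP.*-congʳ {toℚᵘ c} (1+ℕ→ℚᵘ n) ⟩
  ℕ→ℚᵘ (suc n) ℚᵘ.* toℚᵘ c                          ∎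
  where open ℚᵘP.≃-Reasoning

×ℚ-1/ℕ : ∀ n .{{_ : NonZero n}} → n ×ℚ 1/ℕ n ≡ 1ℚ
×ℚ-1/ℕ (suc k) = ℚP.toℚᵘ-injective (begin
  toℚᵘ (suc k ×ℚ (+ 1 / suc k))             ≈⟨ toℚᵘ-×ℚ (suc k) (+ 1 / suc k) ⟩
  ℕ→ℚᵘ (suc k) ℚᵘ.* toℚᵘ (+ 1 / suc k)      ≈⟨ ℚᵘP.*-congˡ {ℕ→ℚᵘ (suc k)} (ℚP.toℚᵘ-fromℚᵘ (mkℚᵘ (+ 1) k)) ⟩
  ℕ→ℚᵘ (suc k) ℚᵘ.* ℚᵘ.1/ ℕ→ℚᵘ (suc k)      ≈⟨ ℚᵘP.*-inverseʳ (ℕ→ℚᵘ (suc k)) ⟩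
  ℚᵘ.1ℚᵘ                                    ∎)
  where open ℚᵘP.≃-Reasoning

indicator : ∀ {n} → Subset n → ℚ → Fin n → ℚ
indicator S c i = if does (i ∈? S) then c else 0ℚ

Σℚ-indicator : ∀ {n} (S : Subset n) c → Σℚ n (indicator S c) ≡ ∣ S ∣ ×ℚ c
Σℚ-indicator []            c = refl
Σℚ-indicator (inside ∷ S)  c = cong (λ t → c + t) (Σℚ-indicator S c)
Σℚ-indicator (outside ∷ S) c = trans (ℚP.+-identityˡ _) (Σℚ-indicator S c)

indicator-nonNeg : ∀ {n} (S : Subset n) {c} → 0ℚ ≤ c → ∀ i → 0ℚ ≤ indicator S c i
indicator-nonNeg S 0≤c i with does (i ∈? S)
... | true  = 0≤c
... | false = ℚP.≤-refl

nonempty⇒∣∣-nonZero : ∀ {n} (S : Subset n) → Nonempty S → NonZero ∣ S ∣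
nonempty⇒∣∣-nonZero (inside ∷ S)  _               = _
nonempty⇒∣∣-nonZero (outside ∷ S) (suc i , there p) = nonempty⇒∣∣-nonZero S (i , p)

+∞-mono : ∀ {a b x y} → fin a ≤∞ x → fin b ≤∞ y → fin (a + b) ≤∞ (x +∞ y)
+∞-mono {x = fin _} {fin _} a≤x b≤y = ℚP.+-mono-≤ a≤x b≤y
+∞-mono {x = fin _} {∞}     _   _   = tt
+∞-mono {x = ∞}             _   _   = tt

Σℚ-mono-≤∞ : ∀ m {g : Fin m → ℚ} {h : Fin m → ℚ∞} →
             (∀ j → fin (g j) ≤∞ h j) → fin (Σℚ m g) ≤∞ Σℚ∞ m h
Σℚ-mono-≤∞ zero    g≤h = ℚP.≤-refl
Σℚ-mono-≤∞ (suc m) g≤h = +∞-mono (g≤h zero) (Σℚ-mono-≤∞ m (λ j → g≤h (suc j)))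

≤-≤∞-trans : ∀ {a b y} → a ≤ b → fin b ≤∞ y → fin a ≤∞ y
≤-≤∞-trans {y = fin _} a≤b b≤y = ℚP.≤-trans a≤b b≤y
≤-≤∞-trans {y = ∞}     _   _   = tt

≤∞-fin-trans : ∀ {a x c} → fin a ≤∞ x → x ≤∞ fin c → a ≤ c
≤∞-fin-trans {x = fin _} a≤x x≤c = ℚP.≤-trans a≤x x≤c

rank≤∣∣ : ∀ {n} {F : Subset n → Set} {r} → IsRankFunctionOf F r → ∀ S → r S ℕ.≤ ∣ S ∣
rank≤∣∣ rank S with proj₁ (rank S)
... | T , T⊆S , _ , ∣T∣≡rS = subst (ℕ._≤ ∣ S ∣) ∣T∣≡rS (p⊆q⇒∣p∣≤∣q∣ T⊆S)

q*1/ℕ≤fval : ∀ {q} → 0ℚ ≤ q → ∀ {ρ s} → ρ ℕ.≤ s → fin (q * 1/ℕ s) ≤∞ fval q ρ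
q*1/ℕ≤fval 0≤q {zero}              _         = tt
q*1/ℕ≤fval {q} 0≤q {suc _} {suc _} (ℕ.s≤s ρ≤s) =
  ℚP.*-monoˡ-≤-nonNeg q {{ℚ.nonNegative 0≤q}} (1/ℕ-antimono-≤ ρ≤s)

*-nonNeg : ∀ {a b} → 0ℚ ≤ a → 0ℚ ≤ b → 0ℚ ≤ a * b
*-nonNeg {a} {b} 0≤a 0≤b = ℚP.nonNegative⁻¹ (a * b)
  {{ℚP.nonNeg*nonNeg⇒nonNeg a {{ℚ.nonNegative 0≤a}} b {{ℚ.nonNegative 0≤b}}}}

if-≤ : ∀ b {a} → 0ℚ ≤ a → (if b then a else 0ℚ) ≤ a
if-≤ true  _   = ℚP.≤-refl
if-≤ false 0≤a = 0≤a

lemma7 : (m n : ℕ)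
    → (F : Fin m → Subset n → Set) → (∀ j → IsMatroid (F j))
    → (r : Fin m → Subset n → ℕ) → (∀ j → IsRankFunctionOf (F j) (r j))
    → (q : Fin m → ℚ) → (∀ j → 0ℚ < q j)
    → (C : ℚ) → (C>0 : 0ℚ < C)
    → (Σ (Fin m → Subset n) λ S → (∀ j → Nonempty (S j))
         × (∀ i → load q r S i ≤∞ fin C))
    → Σ (Fin n → Fin m → ℚ) λ x →
        (∀ j → InJ₁ (q j) C C>0 → Σℚ n (λ i → x i j) ≡ 1ℚ)
      × (∀ i → Σℚ m (λ j → if does (tval (q j) C C>0 ≟ + 1) then q j * x i j else 0ℚ) ≤ C)
      × (∀ i j → InJ₁ (q j) C C>0 → 0ℚ ≤ x i j)
lemma7 m n _ _ r rank q q>0 C C>0 (S , S≢∅ , load≤C) = x , column-sum , machine-load , λ i j _ → x≥0 i j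
  where
  x : Fin n → Fin m → ℚ
  x i j = indicator (S j) (1/ℕ ∣ S j ∣) i

  x≥0 : ∀ i j → 0ℚ ≤ x i j
  x≥0 i j = indicator-nonNeg (S j) (1/ℕ-nonNeg ∣ S j ∣) i

  column-sum : ∀ j → InJ₁ (q j) C C>0 → Σℚ n (λ i → x i j) ≡ 1ℚ
  column-sum j _ = trans (Σℚ-indicator (S j) _) (×ℚ-1/ℕ ∣ S j ∣ {{nonempty⇒∣∣-nonZero (S j) (S≢∅ j)}})

  qx≤f : ∀ i j → fin (q j * x i j) ≤∞ (if does (i ∈? S j) then fval (q j) (r j (S j)) else fin 0ℚ)
  qx≤f i j with does (i ∈? S j)
  ... | true  = q*1/ℕ≤fval (ℚP.<⇒≤ (q>0 j)) (rank≤∣∣ (rank j) (S j))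
  ... | false = ℚP.≤-reflexive (ℚP.*-zeroʳ (q j))

  machine-load : ∀ i → Σℚ m (λ j → if does (tval (q j) C C>0 ≟ + 1) then q j * x i j else 0ℚ) ≤ C
  machine-load i = ≤∞-fin-trans
    (Σℚ-mono-≤∞ m (λ j → ≤-≤∞-trans
      (if-≤ (does (tval (q j) C C>0 ≟ + 1))
            (*-nonNeg (ℚP.<⇒≤ (q>0 j)) (x≥0 i j)))
      (qx≤f i j)))
    (load≤C i)
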